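{- For all first-order models $\mathfrak M$ with domain $M$, teams $X$ over $\mathfrak M$, and first-order formulas $\theta(\bar v,\bar y)$ over the empty signature, where $\bar v$ is a tuple of variables in the domain of $X$ and $\bar y$ is a tuple of distinct variables not in $\bar v$, \[ \mathfrak M\models_X\exists\bar y\,(\mathrm{const}[\bar y]\wedge\theta(\bar v,\bar y))\iff(M,R:=X(\bar v))\models\exists\bar y\,\forall\bar x\,(R\bar x\rightarrow\theta(\bar x,\bar y)). \]
   Context: Team Semantics: all first-order models have domains with at least two elements; first-order formulas are in negation normal form. A team $X$ over a model $\mathfrak M$ with domain $M$ is a set of assignments $s:V\to M$ for a fixed finite set of variables $V$; $X(\bar v)=\{s(\bar v):s\in X\}$. Satisfaction $\mathfrak M\models_X\phi$: for a first-order literal $\alpha$, iff $\mathfrak M\models_s\alpha$ for all $s\in X$; $\phi_1\vee\phi_2$ iff $X=Y\cup Z$ with $\mathfrak M\models_Y\phi_1$, $\mathfrak M\models_Z\phi_2$; $\phi_1\wedge\phi_2$ iff both hold; $\exists v\psi$ iff there is $H:X\to\mathcal P(M)\setminus\{\emptyset\}$ with $\mathfrak M\models_{X[H/v]}\psi$, $X[H/v]=\{s[m/v]:s\in X,m\in H(s)\}$; $\forall v\psi$ iff $\mathfrak M\models_{X[M/v]}\psi$, $X[M/v]=\{s[m/v]:s\in X,m\in M\}$; $\exists\bar y$ abbreviates repeated single quantifiers. The constancy atom: $\mathfrak M\models_X\mathrm{const}[\bar y]$ iff $s(\bar y)=s'(\bar y)$ for all $s,s'\in X$. $(M,R:=X(\bar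 v))$ denotes the structure with domain $M$ interpreting the relation symbol $R$ as $X(\bar v)$. -}

module Defs where

open import Level using (0ℓ; Lift)
open import Data.Nat using (ℕ; _≟_)
open import Data.Bool using (if_then_else_)
open import Data.Product using (Σ; _×_; ∃)
open import Data.Sum using (_⊎_)
open import Data.List using (List; []; _∷_; _++_; filter)
open import Data.Vec using (Vec; []; _∷_; map; foldr)
open import Relation.Nullary using (¬_; yes; no; does)
open import Relation.Nullary.Decidable using (¬?)
open import Relation.Binary.PropositionalEquality using (_≡_; _≢_)
open import Function using (_⇔_)

Var : Set
Var = ℕ

record Model : Set₁ where
  field
    Carrier : Set
    a₀ a₁   : Carrier
    a₀≢a₁   : a₀ ≢ a₁

-- First-order formulas over the empty signature, in negation normal form.

data Fm : Set where
  eq  : Var → Var → Fm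
  neq : Var → Var → Fm
  _∧ᶠ_ : Fm → Fm → Fm
  _∨ᶠ_ : Fm → Fm → Fm
  ∃ᶠ  : Var → Fm → Fm
  ∀ᶠ  : Var → Fm → Fm

FV : Fm → List Var
FV (eq x y)  = x ∷ y ∷ []
FV (neq x y) = x ∷ y ∷ []
FV (φ ∧ᶠ ψ)  = FV φ ++ FV ψ
FV (φ ∨ᶠ ψ)  = FV φ ++ FV ψ
FV (∃ᶠ v φ)  = filter (λ x → ¬? (x ≟ v)) (FV φ)
FV (∀ᶠ v φ)  = filter (λ x → ¬? (x ≟ v)) (FV φ)

module _ {M : Set} where

  Assignment : Set
  Assignment = Var → M

  _[_/_] : Assignment → M → Var → Assignment
  (s [ m / v ]) x = if does (x ≟ v) then m else s x

  -- s[m̄/v̄], updating left to right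
  _[_//_] : ∀ {n} → Assignment → Vec M n → Vec Var n → Assignment
  s [ [] // [] ] = s
  s [ m ∷ ms // v ∷ vs ] = (s [ m / v ]) [ ms // vs ]

  _≗ₐ_ : Assignment → Assignment → Set
  s ≗ₐ t = ∀ x → s x ≡ t x

module _ (𝔐 : Model) where
  open Model 𝔐 renaming (Carrier to M)

  Tarski : (Var → M) → Fm → Set
  Tarski g (eq x y)  = g x ≡ g y
  Tarski g (neq x y) = g x ≢ g y
  Tarski g (φ ∧ᶠ ψ)  = Tarski g φ × Tarski g ψ
  Tarski g (φ ∨ᶠ ψ)  = Tarski g φ ⊎ Tarski g ψ
  Tarski g (∃ᶠ v φ)  = Σ M (λ m → Tarski (g [ m / v ]) φ)
  Tarski g (∀ᶠ v φ)  = (m : M) → Tarski (g [ m / v ]) φ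

data TFm : Set where
  eqᵗ    : Var → Var → TFm
  neqᵗ   : Var → Var → TFm
  const  : ∀ {k} → Vec Var k → TFm
  _∧ᵗ_   : TFm → TFm → TFm
  _∨ᵗ_   : TFm → TFm → TFm
  ∃ᵗ     : Var → TFm → TFm
  ∀ᵗ     : Var → TFm → TFm

⌜_⌝ : Fm → TFm
⌜ eq x y ⌝  = eqᵗ x y
⌜ neq x y ⌝ = neqᵗ x y
⌜ φ ∧ᶠ ψ ⌝  = ⌜ φ ⌝ ∧ᵗ ⌜ ψ ⌝
⌜ φ ∨ᶠ ψ ⌝  = ⌜ φ ⌝ ∨ᵗ ⌜ ψ ⌝
⌜ ∃ᶠ v φ ⌝  = ∃ᵗ v ⌜ φ ⌝
⌜ ∀ᶠ v φ ⌝  = ∀ᵗ v ⌜ φ ⌝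

∃ᵗ* : ∀ {k} → Vec Var k → TFm → TFm
∃ᵗ* ys ψ = foldr _ ∃ᵗ ψ ys

Team : Set → Set₁
Team M = (Var → M) → Set

module _ (𝔐 : Model) where
  open Model 𝔐 renaming (Carrier to M)

  supplement : Team M → ((Var → M) → M → Set) → Var → Team M
  supplement X H v t = Σ (Var → M) λ s → Σ M λ m → X s × H s m × (t ≗ₐ (s [ m / v ]))

  duplicate : Team M → Var → Team M
  duplicate X v t = Σ (Var → M) λ s → Σ M λ m → X s × (t ≗ₐ (s [ m / v ]))

  rel : ∀ {n} → Team M → Vec Var n → Vec M n → Set
  rel X vs as = Σ (Var → M) λ s → X s × (map s vs ≡ as)

  TSat : Team M → TFm → Set₁
  TSat X (eqᵗ x y)  = Lift _ (∀ s → X s → s x ≡ s y)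
  TSat X (neqᵗ x y) = Lift _ (∀ s → X s → s x ≢ s y)
  TSat X (const ys) = Lift _ (∀ s s′ → X s → X s′ → map s ys ≡ map s′ ys)
  TSat X (φ ∧ᵗ ψ)   = TSat X φ × TSat X ψ
  TSat X (φ ∨ᵗ ψ)   = Σ (Team M) λ Y → Σ (Team M) λ Z →
                        ((∀ s → X s ⇔ (Y s ⊎ Z s)) × TSat Y φ × TSat Z ψ)
  TSat X (∃ᵗ v φ)   = Σ ((Var → M) → M → Set) λ H →
                        ((∀ s → X s → Σ M (H s)) × TSat (supplement X H v) φ)
  TSat X (∀ᵗ v φ)   = TSat (duplicate X v) φ

-- First-order formulas are flat: 𝔐 ⊨_X θ iff θ holds at every s ∈ X.  A witness
-- for ∃ȳ (const[ȳ] ∧ θ) extends each s ∈ X to assignments that all give ȳ one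
-- common value b̄, so θ(s(v̄), b̄) holds for every s ∈ X; conversely, supplementing
-- ȳ by the constants b̄ is such a witness.  Reading b̄ off the witnessing team
-- needs an element of X, hence excluded middle (for empty X any b̄ will do).
module Submission where

open import Defs
open import Level using (Level; lift)
open import Axiom.ExcludedMiddle using (ExcludedMiddle)
open import Data.Nat using (ℕ; _≟_)
open import Data.Product using (Σ; _×_; _,_; proj₁; proj₂)
open import Data.Sum using (_⊎_; inj₁; inj₂; [_,_])
open import Data.Vec using (Vec; []; _∷_; map)
open import Data.Vec.Properties using (map-cong)
open import Data.Vec.Membership.Propositional using (_∈_; _∉_)
open import Data.Vec.Relation.Unary.Any using (here; there)
open import Data.Vec.Relation.Unary.All as All using (All)
open import Data.Vec.Relation.Unary.AllPairs using ([]; _∷_)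
open import Data.Vec.Relation.Unary.Unique.Propositional using (Unique)
open import Data.List.Membership.Propositional using () renaming (_∈_ to _∈ˡ_)
open import Data.List.Membership.Propositional.Properties using (∈-++⁺ˡ; ∈-++⁺ʳ; ∈-filter⁺)
open import Data.List.Relation.Unary.Any using () renaming (here to hereˡ; there to thereˡ)
open import Relation.Nullary using (yes; no; ¬?)
open import Relation.Nullary.Decidable using (dec-true; dec-false)
open import Relation.Binary.PropositionalEquality using (_≡_; _≢_; refl; sym; trans; cong₂)
open import Function using (_⇔_; mk⇔; Equivalence)
open import Data.Empty using (⊥-elim)

map-cong-∈ : ∀ {A B : Set} {n} {f g : A → B} (xs : Vec A n) →
             (∀ x → x ∈ xs → f x ≡ g x) → map f xs ≡ map g xs
map-cong-∈ []       f≈g = refl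
map-cong-∈ (x ∷ xs) f≈g = cong₂ _∷_ (f≈g x (here refl)) (map-cong-∈ xs (λ y y∈xs → f≈g y (there y∈xs)))

module _ {M : Set} where

  [/]-same : (s : Var → M) (m : M) (v : Var) → (s [ m / v ]) v ≡ m
  [/]-same s m v rewrite dec-true (v ≟ v) refl = refl

  [/]-other : (s : Var → M) (m : M) {v x : Var} → x ≢ v → (s [ m / v ]) x ≡ s x
  [/]-other s m {v} {x} x≢v rewrite dec-false (x ≟ v) x≢v = refl

  [/]-cong : (s t : Var → M) (m : M) (v : Var) {x : Var} →
             (x ≢ v → s x ≡ t x) → (s [ m / v ]) x ≡ (t [ m / v ]) x
  [/]-cong s t m v {x} sx≡tx with x ≟ v
  ... | yes refl = trans ([/]-same s m x) (sym ([/]-same t m x))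
  ... | no x≢v   = trans ([/]-other s m x≢v) (trans (sx≡tx x≢v) (sym ([/]-other t m x≢v)))

  [//]-cong : ∀ {k} {s t : Var → M} → s ≗ₐ t →
              (bs : Vec M k) (ys : Vec Var k) → (s [ bs // ys ]) ≗ₐ (t [ bs // ys ])
  [//]-cong s≈t []       []       = s≈t
  [//]-cong {s = s} {t} s≈t (b ∷ bs) (y ∷ ys) = [//]-cong (λ x → [/]-cong s t b y (λ _ → s≈t x)) bs ys

  [//]-∉ : ∀ {k} (s : Var → M) (bs : Vec M k) (ys : Vec Var k) {x : Var} →
           x ∉ ys → (s [ bs // ys ]) x ≡ s x
  [//]-∉ s []       []       x∉ys = refl
  [//]-∉ s (b ∷ bs) (y ∷ ys) x∉ys =
    trans ([//]-∉ (s [ b / y ]) bs ys (λ x∈ys → x∉ys (there x∈ys)))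
          ([/]-other s b (λ x≡y → x∉ys (here x≡y)))

  [//]-map-preserves : ∀ {n} (s t : Var → M) (vs : Vec Var n) {x : Var} →
                       s x ≡ t x → (s [ map t vs // vs ]) x ≡ t x
  [//]-map-preserves s t []       sx≡tx = sx≡tx
  [//]-map-preserves s t (v ∷ vs) {x} sx≡tx = [//]-map-preserves (s [ t v / v ]) t vs updated
    where
    updated : (s [ t v / v ]) x ≡ t x
    updated with x ≟ v
    ... | yes refl = [/]-same s (t x) x
    ... | no x≢v   = trans ([/]-other s (t v) x≢v) sx≡tx

  [//]-map-∈ : ∀ {n} (s t : Var → M) (vs : Vec Var n) {x : Var} →
               x ∈ vs → (s [ map t vs // vs ]) x ≡ t x
  [//]-map-∈ s t (v ∷ vs) (here refl) = [//]-map-preserves (s [ t v / v ]) t vs ([/]-same s (t v) v)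
  [//]-map-∈ s t (v ∷ vs) (there x∈vs) = [//]-map-∈ (s [ t v / v ]) t vs x∈vs

  map-[//]-Unique : ∀ {k} (s : Var → M) (bs : Vec M k) (ys : Vec Var k) →
                    Unique ys → map (s [ bs // ys ]) ys ≡ bs
  map-[//]-Unique s []       []       []                = refl
  map-[//]-Unique s (b ∷ bs) (y ∷ ys) (y∉ys ∷ ys-unique) =
    cong₂ _∷_ (trans ([//]-∉ (s [ b / y ]) bs ys (All.lookupWith (λ y≢z y≡z → y≢z y≡z) y∉ys))
                     ([/]-same s b y))
              (map-[//]-Unique (s [ b / y ]) bs ys ys-unique)

  _⟦_//_⟧ : ∀ {k} → Team M → Vec M k → Vec Var k → Team M
  (X ⟦ bs // ys ⟧) t = Σ (Var → M) λ s → X s × (t ≗ₐ (s [ bs // ys ]))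

module _ (𝔐 : Model) where
  open Model 𝔐 renaming (Carrier to M)

  binder-cong : (v : Var) (φ : Fm) {g h : Var → M} →
                (∀ x → x ∈ˡ FV (∃ᶠ v φ) → g x ≡ h x) →
                (m : M) → ∀ x → x ∈ˡ FV φ → (g [ m / v ]) x ≡ (h [ m / v ]) x
  binder-cong v φ {g} {h} g≈h m x x∈φ =
    [/]-cong g h m v (λ x≢v → g≈h x (∈-filter⁺ (λ z → ¬? (z ≟ v)) x∈φ x≢v))

  Tarski-coincidence : (φ : Fm) {g h : Var → M} →
                       (∀ x → x ∈ˡ FV φ → g x ≡ h x) → Tarski 𝔐 g φ → Tarski 𝔐 h φ
  Tarski-coincidence (eq x y)  g≈h gx≡gy =
    trans (sym (g≈h x (hereˡ refl))) (trans gx≡gy (g≈h y (thereˡ (hereˡ refl))))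
  Tarski-coincidence (neq x y) g≈h gx≢gy hx≡hy =
    gx≢gy (trans (g≈h x (hereˡ refl)) (trans hx≡hy (sym (g≈h y (thereˡ (hereˡ refl))))))
  Tarski-coincidence (φ ∧ᶠ ψ) g≈h (gφ , gψ) =
    Tarski-coincidence φ (λ x i → g≈h x (∈-++⁺ˡ i)) gφ ,
    Tarski-coincidence ψ (λ x i → g≈h x (∈-++⁺ʳ (FV φ) i)) gψ
  Tarski-coincidence (φ ∨ᶠ ψ) g≈h (inj₁ gφ) = inj₁ (Tarski-coincidence φ (λ x i → g≈h x (∈-++⁺ˡ i)) gφ)
  Tarski-coincidence (φ ∨ᶠ ψ) g≈h (inj₂ gψ) = inj₂ (Tarski-coincidence ψ (λ x i → g≈h x (∈-++⁺ʳ (FV φ) i)) gψ)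
  Tarski-coincidence (∃ᶠ v φ) g≈h (m , gφ) = m , Tarski-coincidence φ (binder-cong v φ g≈h m) gφ
  Tarski-coincidence (∀ᶠ v φ) g≈h gφ m = Tarski-coincidence φ (binder-cong v φ g≈h m) (gφ m)

  Tarski-≗ₐ : (φ : Fm) {g h : Var → M} → g ≗ₐ h → Tarski 𝔐 g φ → Tarski 𝔐 h φ
  Tarski-≗ₐ φ g≈h = Tarski-coincidence φ (λ x _ → g≈h x)

  TSat-⌜⌝⇒Tarski : (φ : Fm) (X : Team M) → TSat 𝔐 X ⌜ φ ⌝ → ∀ s → X s → Tarski 𝔐 s φ
  TSat-⌜⌝⇒Tarski (eq x y)  X (lift sat) = sat
  TSat-⌜⌝⇒Tarski (neq x y) X (lift sat) = sat
  TSat-⌜⌝⇒Tarski (φ ∧ᶠ ψ) X (satφ , satψ) s Xs =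
    TSat-⌜⌝⇒Tarski φ X satφ s Xs , TSat-⌜⌝⇒Tarski ψ X satψ s Xs
  TSat-⌜⌝⇒Tarski (φ ∨ᶠ ψ) X (Y , Z , X≡Y∪Z , satφ , satψ) s Xs with Equivalence.to (X≡Y∪Z s) Xs
  ... | inj₁ Ys = inj₁ (TSat-⌜⌝⇒Tarski φ Y satφ s Ys)
  ... | inj₂ Zs = inj₂ (TSat-⌜⌝⇒Tarski ψ Z satψ s Zs)
  TSat-⌜⌝⇒Tarski (∃ᶠ v φ) X (H , H-total , sat) s Xs =
    let m , Hsm = H-total s Xs in
    m , TSat-⌜⌝⇒Tarski φ (supplement 𝔐 X H v) sat (s [ m / v ]) (s , m , Xs , Hsm , λ _ → refl)
  TSat-⌜⌝⇒Tarski (∀ᶠ v φ) X sat s Xs m =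
    TSat-⌜⌝⇒Tarski φ (duplicate 𝔐 X v) sat (s [ m / v ]) (s , m , Xs , λ _ → refl)

  Tarski⇒TSat-⌜⌝ : (φ : Fm) (X : Team M) → (∀ s → X s → Tarski 𝔐 s φ) → TSat 𝔐 X ⌜ φ ⌝
  Tarski⇒TSat-⌜⌝ (eq x y)  X sat = lift sat
  Tarski⇒TSat-⌜⌝ (neq x y) X sat = lift sat
  Tarski⇒TSat-⌜⌝ (φ ∧ᶠ ψ) X sat =
    Tarski⇒TSat-⌜⌝ φ X (λ s Xs → proj₁ (sat s Xs)) , Tarski⇒TSat-⌜⌝ ψ X (λ s Xs → proj₂ (sat s Xs))
  Tarski⇒TSat-⌜⌝ (φ ∨ᶠ ψ) X sat =
    (λ s → X s × Tarski 𝔐 s φ) , (λ s → X s × Tarski 𝔐 s ψ) ,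
    (λ s → mk⇔ (λ Xs → [ (λ satφ → inj₁ (Xs , satφ)) , (λ satψ → inj₂ (Xs , satψ)) ] (sat s Xs))
               [ proj₁ , proj₁ ]) ,
    Tarski⇒TSat-⌜⌝ φ _ (λ _ → proj₂) , Tarski⇒TSat-⌜⌝ ψ _ (λ _ → proj₂)
  Tarski⇒TSat-⌜⌝ (∃ᶠ v φ) X sat =
    (λ s m → Tarski 𝔐 (s [ m / v ]) φ) , sat ,
    Tarski⇒TSat-⌜⌝ φ _ (λ { t (s , m , _ , satφ , t≈s[m/v]) → Tarski-≗ₐ φ (λ x → sym (t≈s[m/v] x)) satφ })
  Tarski⇒TSat-⌜⌝ (∀ᶠ v φ) X sat =
    Tarski⇒TSat-⌜⌝ φ _ (λ { t (s , m , Xs , t≈s[m/v]) → Tarski-≗ₐ φ (λ x → sym (t≈s[m/v] x)) (sat s Xs m) })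

  TSat-⊆ : (φ : TFm) {X Y : Team M} → (∀ s → Y s → X s) → TSat 𝔐 X φ → TSat 𝔐 Y φ
  TSat-⊆ (eqᵗ x y)  Y⊆X (lift sat) = lift (λ s Ys → sat s (Y⊆X s Ys))
  TSat-⊆ (neqᵗ x y) Y⊆X (lift sat) = lift (λ s Ys → sat s (Y⊆X s Ys))
  TSat-⊆ (const ys) Y⊆X (lift sat) = lift (λ s s′ Ys Ys′ → sat s s′ (Y⊆X s Ys) (Y⊆X s′ Ys′))
  TSat-⊆ (φ ∧ᵗ ψ) Y⊆X (satφ , satψ) = TSat-⊆ φ Y⊆X satφ , TSat-⊆ ψ Y⊆X satψ
  TSat-⊆ (φ ∨ᵗ ψ) {Y = Y} Y⊆X (X₁ , X₂ , X≡X₁∪X₂ , satφ , satψ) =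
    (λ s → Y s × X₁ s) , (λ s → Y s × X₂ s) ,
    (λ s → mk⇔ (λ Ys → [ (λ X₁s → inj₁ (Ys , X₁s)) , (λ X₂s → inj₂ (Ys , X₂s)) ]
                           (Equivalence.to (X≡X₁∪X₂ s) (Y⊆X s Ys)))
               [ proj₁ , proj₁ ]) ,
    TSat-⊆ φ (λ _ → proj₂) satφ , TSat-⊆ ψ (λ _ → proj₂) satψ
  TSat-⊆ (∃ᵗ v φ) Y⊆X (H , H-total , sat) =
    H , (λ s Ys → H-total s (Y⊆X s Ys)) ,
    TSat-⊆ φ (λ { t (s , m , Ys , Hsm , e) → s , m , Y⊆X s Ys , Hsm , e }) sat
  TSat-⊆ (∀ᵗ v φ) Y⊆X sat = TSat-⊆ φ (λ { t (s , m , Ys , e) → s , m , Y⊆X s Ys , e }) sat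

  ∃ᵗ*-elim : ∀ {k} (ys : Vec Var k) (ψ : TFm) (X : Team M) → TSat 𝔐 X (∃ᵗ* ys ψ) →
             Σ (Team M) λ X′ → TSat 𝔐 X′ ψ ×
               (∀ s → X s → Σ (Var → M) λ t → X′ t × (∀ x → x ∉ ys → t x ≡ s x))
  ∃ᵗ*-elim []       ψ X sat = X , sat , λ s Xs → s , Xs , λ _ _ → refl
  ∃ᵗ*-elim (y ∷ ys) ψ X (H , H-total , sat) =
    let X′ , satψ , extend = ∃ᵗ*-elim ys ψ (supplement 𝔐 X H y) sat in
    X′ , satψ , λ s Xs →
      let m , Hsm = H-total s Xs
          t , X′t , t≈s[m/y] = extend (s [ m / y ]) (s , m , Xs , Hsm , λ _ → refl)
      in t , X′t , λ x x∉y∷ys → trans (t≈s[m/y] x (λ x∈ys → x∉y∷ys (there x∈ys)))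
                                        ([/]-other s m (λ x≡y → x∉y∷ys (here x≡y)))

  ∃ᵗ*-intro : ∀ {k} (ys : Vec Var k) (bs : Vec M k) (ψ : TFm) (X : Team M) →
              TSat 𝔐 (X ⟦ bs // ys ⟧) ψ → TSat 𝔐 X (∃ᵗ* ys ψ)
  ∃ᵗ*-intro []       []       ψ X sat = TSat-⊆ ψ (λ s Xs → s , Xs , λ _ → refl) sat
  ∃ᵗ*-intro (y ∷ ys) (b ∷ bs) ψ X sat =
    (λ _ m → m ≡ b) , (λ _ _ → b , refl) ,
    ∃ᵗ*-intro ys bs ψ (supplement 𝔐 X (λ _ m → m ≡ b) y) (TSat-⊆ ψ shifted sat)
    where
    shifted : ∀ t → (supplement 𝔐 X (λ _ m → m ≡ b) y ⟦ bs // ys ⟧) t → (X ⟦ b ∷ bs // y ∷ ys ⟧) t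
    shifted t (s′ , (s , _ , Xs , refl , s′≈s[b/y]) , t≈s′[bs/ys]) =
      s , Xs , λ x → trans (t≈s′[bs/ys] x) ([//]-cong s′≈s[b/y] bs ys x)

module _ (𝔐 : Model) (X : Team (Model.Carrier 𝔐)) (θ : Fm) {n k : ℕ} (vs : Vec Var n) (ys : Vec Var k)
         (vs∩ys≡∅ : ∀ x → x ∈ vs → x ∉ ys) (FVθ⊆vs∪ys : ∀ x → x ∈ˡ FV θ → x ∈ vs ⊎ x ∈ ys) where
  open Model 𝔐 renaming (Carrier to M)

  canonical : Vec M n → Vec M k → Var → M
  canonical as bs = ((λ _ → a₀) [ as // vs ]) [ bs // ys ]

  Tarski-canonical : {t : Var → M} {as : Vec M n} {bs : Vec M k} → map t vs ≡ as → map t ys ≡ bs →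
                     Tarski 𝔐 t θ ⇔ Tarski 𝔐 (canonical as bs) θ
  Tarski-canonical {t} refl refl =
    mk⇔ (Tarski-coincidence 𝔐 θ (λ x x∈θ → sym (agrees x x∈θ))) (Tarski-coincidence 𝔐 θ agrees)
    where
    agrees : ∀ x → x ∈ˡ FV θ → canonical (map t vs) (map t ys) x ≡ t x
    agrees x x∈θ with FVθ⊆vs∪ys x x∈θ
    ... | inj₁ x∈vs = trans ([//]-∉ _ (map t ys) ys (vs∩ys≡∅ x x∈vs)) ([//]-map-∈ (λ _ → a₀) t vs x∈vs)
    ... | inj₂ x∈ys = [//]-map-∈ _ t ys x∈ys

  agree-off-ys⇒map-vs : {s t : Var → M} → (∀ x → x ∉ ys → t x ≡ s x) → map t vs ≡ map s vs
  agree-off-ys⇒map-vs t≈s = map-cong-∈ vs (λ x x∈vs → t≈s x (vs∩ys≡∅ x x∈vs))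

  Witness : Vec M k → Set
  Witness bs = (as : Vec M n) → rel 𝔐 X vs as → Tarski 𝔐 (canonical as bs) θ

  ∃ᵗ*-const⇒Witness : (∀ {ℓ : Level} → ExcludedMiddle ℓ) →
                      TSat 𝔐 X (∃ᵗ* ys (const ys ∧ᵗ ⌜ θ ⌝)) → Σ (Vec M k) Witness
  ∃ᵗ*-const⇒Witness lem sat with ∃ᵗ*-elim 𝔐 ys _ X sat | lem {P = Σ (Var → M) X}
  ... | _ | no X-empty = map (λ _ → a₀) ys , λ { _ (s , Xs , _) → ⊥-elim (X-empty (s , Xs)) }
  ... | X′ , (lift ys-const , satθ) , extend | yes (s₀ , Xs₀) with extend s₀ Xs₀
  ... | t₀ , X′t₀ , _ = map t₀ ys , witness
    where
    witness : Witness (map t₀ ys)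
    witness _ (s , Xs , refl) =
      let t , X′t , t≈s = extend s Xs in
      Equivalence.to (Tarski-canonical (agree-off-ys⇒map-vs t≈s) (ys-const t t₀ X′t X′t₀))
                     (TSat-⌜⌝⇒Tarski 𝔐 θ X′ satθ t X′t)

  Witness⇒∃ᵗ*-const : Unique ys → Σ (Vec M k) Witness → TSat 𝔐 X (∃ᵗ* ys (const ys ∧ᵗ ⌜ θ ⌝))
  Witness⇒∃ᵗ*-const ys-unique (bs , witness) =
    ∃ᵗ*-intro 𝔐 ys bs _ X
      (lift (λ t t′ Xt Xt′ → trans (map-ys≡bs Xt) (sym (map-ys≡bs Xt′))) , Tarski⇒TSat-⌜⌝ 𝔐 θ _ θ-holds)
    where
    map-ys≡bs : ∀ {t} → (X ⟦ bs // ys ⟧) t → map t ys ≡ bs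
    map-ys≡bs (s , _ , t≈s[bs/ys]) = trans (map-cong t≈s[bs/ys] ys) (map-[//]-Unique s bs ys ys-unique)
    θ-holds : ∀ t → (X ⟦ bs // ys ⟧) t → Tarski 𝔐 t θ
    θ-holds t t∈X[bs/ys]@(s , Xs , t≈s[bs/ys]) =
      Equivalence.from (Tarski-canonical t-vs≡s-vs (map-ys≡bs t∈X[bs/ys])) (witness (map s vs) (s , Xs , refl))
      where
      t-vs≡s-vs : map t vs ≡ map s vs
      t-vs≡s-vs = agree-off-ys⇒map-vs (λ x x∉ys → trans (t≈s[bs/ys] x) ([//]-∉ s bs ys x∉ys))

lemma7 : (∀ {ℓ : Level} → ExcludedMiddle ℓ) →
    (𝔐 : Model) (X : Team (Model.Carrier 𝔐)) (θ : Fm)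
    {n k : ℕ} (vs : Vec Var n) (ys : Vec Var k) →
    Unique ys →
    (∀ y → y ∈ ys → y ∉ vs) →
    (∀ x → x ∈ˡ FV θ → x ∈ vs ⊎ x ∈ ys) →
    TSat 𝔐 X (∃ᵗ* ys (const ys ∧ᵗ ⌜ θ ⌝))
      ⇔ Σ (Vec (Model.Carrier 𝔐) k) (λ bs →
            (as : Vec (Model.Carrier 𝔐) n) → rel 𝔐 X vs as →
            Tarski 𝔐 (((λ _ → Model.a₀ 𝔐) [ as // vs ]) [ bs // ys ]) θ)
lemma7 lem 𝔐 X θ vs ys ys-unique ys∩vs≡∅ FVθ⊆vs∪ys =
  mk⇔ (∃ᵗ*-const⇒Witness 𝔐 X θ vs ys vs∩ys≡∅ FVθ⊆vs∪ys lem)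
      (Witness⇒∃ᵗ*-const 𝔐 X θ vs ys vs∩ys≡∅ FVθ⊆vs∪ys ys-unique)
  where
  vs∩ys≡∅ : ∀ x → x ∈ vs → x ∉ ys
  vs∩ys≡∅ x x∈vs x∈ys = ys∩vs≡∅ x x∈ys x∈vs
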